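{- Let $G=(V,E)$ be a connected graph with non-negative vertex and edge weights and start vertex $v_s$, and let $T$ be a minimum spanning tree of $G$ (with respect to the edge weights), carrying the induced vertex and edge weights. Let $k_{\mathrm{opt}}$ be the minimum number of agents of an optimal deployment strategy for $G$, and $k_{\mathrm{MST}}$ the minimum number of agents of an optimal deployment strategy for $T$ (same start vertex, same variant). Then $k_{\mathrm{MST}}\le 2k_{\mathrm{opt}}$; i.e., an optimal deployment strategy for the minimum spanning tree (which is also a valid strategy for $G$) gives a $2$-approximation of the optimal deployment strategy of $G$.
   Context: Strategic deployment problem: Let $G=(V,E)$ be a connected graph with non-negative vertex weights $w_v$ and edge weights $w_e$, and let $v_s\in V$ be a start vertex. Some number $k$ of agents start at $v_s$. Time proceeds in discrete steps; in each step every non-settled agent either stays at its vertex or moves along an incident edge (agents may move in several groups). When a vertex $v$ is reached by agents for the first time, $w_v$ of the agents present must be left at $v$ permanently (settled); $v$ is then filled. An edge $e$ may be traversed in a step only if at least $w_e$ agents traverse it together. A strategy is valid if every vertex gets filled. In the return variant, finally a set $M$ of agents must return to $v_s$ such that the union of the vertices visited by members of $M$ is $V$; in the no-return variant nothing has to return. An optimal deployment strategy is a valid strategy with the minimum number of agents. -}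

module Defs where

open import Data.Nat using (ℕ; zero; suc; _+_; _*_; _≤_; _<_)
import Data.Nat
open import Data.Fin using (Fin; zero; suc; _≟_)
open import Data.Bool using (Bool; true; false; if_then_else_; _∧_)
open import Data.Maybe using (Maybe; just; nothing)
open import Data.Product using (Σ; ∃; ∃-syntax; _×_; _,_)
open import Data.Sum using (_⊎_)
open import Relation.Nullary using (¬_)
open import Relation.Nullary.Decidable using (⌊_⌋)
open import Relation.Binary.PropositionalEquality using (_≡_; _≢_)

-- Weighted (multi)graphs: vertices Fin n, edges Fin m, each edge e has
-- endpoints src e, dst e; edge weights ew, vertex weights vw (ℕ, hence
-- non-negative).

record WGraph : Set where
  field
    n   : ℕ
    m   : ℕ
    src : Fin m → Fin n
    dst : Fin m → Fin n
    ew  : Fin m → ℕ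
    vw  : Fin n → ℕ

-- A subgraph on the same vertex set is given by a set of edges
-- (characteristic function on edge indices).  The whole graph G is
-- 'allEdges'; a spanning subgraph (e.g. a tree) is some S.
EdgeSet : WGraph → Set
EdgeSet G = Fin (WGraph.m G) → Bool

allEdges : (G : WGraph) → EdgeSet G
allEdges G _ = true

removeEdge : (G : WGraph) → EdgeSet G → Fin (WGraph.m G) → EdgeSet G
removeEdge G S e f = if ⌊ e ≟ f ⌋ then false else S f

Joins : (G : WGraph) → Fin (WGraph.m G) → Fin (WGraph.n G) → Fin (WGraph.n G) → Set
Joins G e u v = (WGraph.src G e ≡ u × WGraph.dst G e ≡ v) ⊎ (WGraph.src G e ≡ v × WGraph.dst G e ≡ u)

data Reach (G : WGraph) (S : EdgeSet G) : Fin (WGraph.n G) → Fin (WGraph.n G) → Set where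
  here : ∀ {u} → Reach G S u u
  step : ∀ {u v w} (e : Fin (WGraph.m G)) → S e ≡ true → Joins G e u v →
         Reach G S v w → Reach G S u w

Connected : (G : WGraph) → EdgeSet G → Set
Connected G S = ∀ u v → Reach G S u v

-- A spanning tree: a connected spanning subgraph in which every edge is
-- a bridge (i.e. a minimally connected spanning subgraph = acyclic).
IsSpanningTree : (G : WGraph) → EdgeSet G → Set
IsSpanningTree G S =
  Connected G S ×
  (∀ e → S e ≡ true → ¬ Reach G (removeEdge G S e) (WGraph.src G e) (WGraph.dst G e))

count : ∀ {k} → (Fin k → Bool) → ℕ
count {zero}  p = 0
count {suc k} p = (if p zero then 1 else 0) + count (λ i → p (suc i))

sumFin : ∀ {k} → (Fin k → ℕ) → ℕ
sumFin {zero}  f = 0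
sumFin {suc k} f = f zero + sumFin (λ i → f (suc i))

weight : (G : WGraph) → EdgeSet G → ℕ
weight G S = sumFin (λ e → if S e then WGraph.ew G e else 0)

IsMST : (G : WGraph) → EdgeSet G → Set
IsMST G S = IsSpanningTree G S × (∀ S' → IsSpanningTree G S' → weight G S ≤ weight G S')

data Variant : Set where
  withReturn noReturn : Variant

eqMaybeFin : ∀ {m} → Maybe (Fin m) → Maybe (Fin m) → Bool
eqMaybeFin (just a) (just b) = ⌊ a ≟ b ⌋
eqMaybeFin nothing  nothing  = true
eqMaybeFin _        _        = false

eqMaybeℕ : Maybe ℕ → Maybe ℕ → Bool
eqMaybeℕ (just a) (just b) = ⌊ a Data.Nat.≟ b ⌋
eqMaybeℕ nothing  nothing  = true
eqMaybeℕ _        _        = false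

-- A (discrete-time, unbounded) schedule for k agents on G using only
-- edges of S.  pos t a : vertex of agent a at time t;
-- mv t a : nothing = agent a stays during step t → t+1,
--          just e  = agent a traverses edge e during that step;
-- settle a : just s = agent a is settled (at vertex pos s a) at time s.
record Schedule (G : WGraph) (k : ℕ) : Set where
  field
    pos    : ℕ → Fin k → Fin (WGraph.n G)
    mv     : ℕ → Fin k → Maybe (Fin (WGraph.m G))
    settle : Fin k → Maybe ℕ

FirstVisit : {G : WGraph} {k : ℕ} → Schedule G k → Fin (WGraph.n G) → ℕ → Set
FirstVisit σ v t =
  (∃[ a ] Schedule.pos σ t a ≡ v) × (∀ t' → t' < t → ∀ a → Schedule.pos σ t' a ≢ v)

settledCount : {G : WGraph} {k : ℕ} → Schedule G k → Fin (WGraph.n G) → ℕ → ℕ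
settledCount {G} σ v t =
  count (λ a → eqMaybeℕ (Schedule.settle σ a) (just t) ∧ ⌊ Schedule.pos σ t a ≟ v ⌋)

groupSize : {G : WGraph} {k : ℕ} → Schedule G k → ℕ → Fin (WGraph.m G) → Fin (WGraph.n G) → ℕ
groupSize σ t e u =
  count (λ b → eqMaybeFin (Schedule.mv σ t b) (just e) ∧ ⌊ Schedule.pos σ t b ≟ u ⌋)

record ValidStrategy (G : WGraph) (S : EdgeSet G) (var : Variant)
                     (vs : Fin (WGraph.n G)) (k : ℕ) (σ : Schedule G k) : Set where
  open Schedule σ
  field
    start     : ∀ a → pos 0 a ≡ vs
    stay      : ∀ t a → mv t a ≡ nothing → pos (suc t) a ≡ pos t a
    move      : ∀ t a e → mv t a ≡ just e →
                S e ≡ true × Joins G e (pos t a) (pos (suc t) a)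
    capacity  : ∀ t a e → mv t a ≡ just e → WGraph.ew G e ≤ groupSize σ t e (pos t a)
    settled   : ∀ a s → settle a ≡ just s → ∀ t → s ≤ t → mv t a ≡ nothing
    settleFirst : ∀ a s → settle a ≡ just s → FirstVisit σ (pos s a) s
    filled    : ∀ v → ∃[ t ] (FirstVisit σ v t × settledCount σ v t ≡ WGraph.vw G v)
    returns   : var ≡ withReturn →
                ∃[ T ] (∀ v → ∃[ a ] (pos T a ≡ vs × ∃[ t ] (t ≤ T × pos t a ≡ v)))

Deployable : (G : WGraph) → EdgeSet G → Variant → Fin (WGraph.n G) → ℕ → Set
Deployable G S var vs k = Σ (Schedule G k) (ValidStrategy G S var vs k)

OptimalAgents : (G : WGraph) → EdgeSet G → Variant → Fin (WGraph.n G) → ℕ → Set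
OptimalAgents G S var vs k =
  Deployable G S var vs k × (∀ k' → Deployable G S var vs k' → k ≤ k')

-- A group crossing an edge e has at least w_e and at most k agents, so in a strategy with k agents
-- the edges of weight at most k connect G; by the cut property of minimum spanning trees every edge
-- of T then weighs at most k. On T, k carriers walk a closed tour through all vertices as one group,
-- which can cross every tree edge, and k further agents ride along: the copy of an agent settling at
-- d in the given strategy leaves the tour when it first reaches d. Since the carriers return to the
-- start, this is a valid strategy with 2k agents in either variant.

module Submission where

open import Defs
open import Data.Nat using (ℕ; zero; suc; _+_; _*_; _≤_; _<_; z≤n; s≤s; _⊓_)
import Data.Nat as ℕ
open import Data.Nat.Properties hiding (_≟_; suc-injective)
open import Data.Fin using (Fin; zero; suc; _≟_; splitAt; _↑ˡ_; _↑ʳ_)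
open import Data.Fin.Properties using (suc-injective; splitAt-↑ˡ; splitAt-↑ʳ)
open import Data.Bool using (Bool; true; false; if_then_else_; _∧_)
open import Data.Bool.Properties using (¬-not)
open import Data.Maybe using (Maybe; just; nothing; is-nothing)
import Data.Maybe as Maybe
open import Data.Product using (Σ; ∃-syntax; ∃₂; _×_; _,_; proj₁; proj₂)
open import Data.Sum using (_⊎_; inj₁; inj₂; [_,_]′)
open import Function using (_∘_; const)
open import Relation.Nullary using (¬_; yes; no; contradiction)
open import Relation.Nullary.Decidable using (⌊_⌋; isYes≗does; dec-true; dec-false)
open import Relation.Unary using (Decidable)
open import Relation.Binary.PropositionalEquality
open import Relation.Binary.Definitions using (tri<; tri≈; tri>)

least : ∀ {P : ℕ → Set} → Decidable P → ∀ {n} → P n →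
        ∃[ m ] (m ≤ n × P m × (∀ i → i < m → ¬ P i))
least P? {zero} p = 0 , z≤n , p , λ _ ()
least P? {suc n} p with P? 0
... | yes p₀ = 0 , z≤n , p₀ , λ _ ()
... | no ¬p₀ with least (P? ∘ suc) {n} p
...   | m , m≤n , pm , below = suc m , s≤s m≤n , pm , earlier
  where
  earlier : ∀ i → i < suc m → ¬ _
  earlier zero    _           = ¬p₀
  earlier (suc i) (s≤s i<m) = below i i<m

sumFin-ext : ∀ {k} {f g : Fin k → ℕ} → (∀ i → f i ≡ g i) → sumFin f ≡ sumFin g
sumFin-ext {zero}  eq = refl
sumFin-ext {suc k} eq = cong₂ _+_ (eq zero) (sumFin-ext (eq ∘ suc))

sumFin-update : ∀ {k} (f g : Fin k → ℕ) (e : Fin k) → (∀ i → i ≢ e → f i ≡ g i) →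
                sumFin f + g e ≡ sumFin g + f e
sumFin-update f g zero agree = begin
  f zero + sumFin (f ∘ suc) + g zero ≡⟨ cong (λ s → f zero + s + g zero) rest ⟩
  f zero + sumFin (g ∘ suc) + g zero ≡⟨ +-comm (f zero + _) (g zero) ⟩
  g zero + (f zero + sumFin (g ∘ suc)) ≡⟨ cong (g zero +_) (+-comm (f zero) _) ⟩
  g zero + (sumFin (g ∘ suc) + f zero) ≡⟨ +-assoc (g zero) _ _ ⟨
  g zero + sumFin (g ∘ suc) + f zero ∎
  where
  open ≡-Reasoning
  rest : sumFin (f ∘ suc) ≡ sumFin (g ∘ suc)
  rest = sumFin-ext (λ i → agree (suc i) λ ())
sumFin-update f g (suc e) agree = begin
  f zero + sumFin (f ∘ suc) + g (suc e)   ≡⟨ +-assoc (f zero) _ _ ⟩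
  f zero + (sumFin (f ∘ suc) + g (suc e)) ≡⟨ cong₂ _+_ (agree zero λ ()) rest ⟩
  g zero + (sumFin (g ∘ suc) + f (suc e)) ≡⟨ +-assoc (g zero) _ _ ⟨
  g zero + sumFin (g ∘ suc) + f (suc e)   ∎
  where
  open ≡-Reasoning
  rest : sumFin (f ∘ suc) + g (suc e) ≡ sumFin (g ∘ suc) + f (suc e)
  rest = sumFin-update (f ∘ suc) (g ∘ suc) e (λ i i≢e → agree (suc i) (i≢e ∘ suc-injective))

count-ext : ∀ {k} {p q : Fin k → Bool} → (∀ i → p i ≡ q i) → count p ≡ count q
count-ext {zero}  eq = refl
count-ext {suc k} eq = cong₂ _+_ (cong (λ b → if b then 1 else 0) (eq zero)) (count-ext (eq ∘ suc))

count-mono : ∀ {k} {p q : Fin k → Bool} → (∀ i → p i ≡ true → q i ≡ true) → count p ≤ count q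
count-mono {zero} p⇒q = z≤n
count-mono {suc k} {p} {q} p⇒q with p zero in p₀ | q zero in q₀
... | true  | true  = s≤s (count-mono (p⇒q ∘ suc))
... | true  | false = contradiction (trans (sym (p⇒q zero p₀)) q₀) λ ()
... | false | true  = m≤n⇒m≤1+n (count-mono (p⇒q ∘ suc))
... | false | false = count-mono (p⇒q ∘ suc)

count-true : ∀ {k} {p : Fin k → Bool} → (∀ i → p i ≡ true) → count p ≡ k
count-true {zero}  all = refl
count-true {suc k} all rewrite all zero = cong suc (count-true (all ∘ suc))

count-false : ∀ {k} {p : Fin k → Bool} → (∀ i → p i ≡ false) → count p ≡ 0
count-false {zero}  none = refl
count-false {suc k} none rewrite none zero = count-false (none ∘ suc)

count-≤ : ∀ {k} (p : Fin k → Bool) → count p ≤ k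
count-≤ {k} p =
  ≤-trans (count-mono {k} {p} {const true} (λ _ _ → refl)) (≤-reflexive (count-true λ _ → refl))

count-++ : ∀ m {n} (p : Fin (m + n) → Bool) →
           count p ≡ count (p ∘ (_↑ˡ n)) + count (p ∘ (m ↑ʳ_))
count-++ zero    p = refl
count-++ (suc m) p =
  trans (cong (head +_) (count-++ m (p ∘ suc))) (sym (+-assoc head _ _))
  where
  head : ℕ
  head = if p zero then 1 else 0

⌊≟⌋-refl : ∀ {n} (i : Fin n) → ⌊ i ≟ i ⌋ ≡ true
⌊≟⌋-refl i = trans (isYes≗does (i ≟ i)) (dec-true (i ≟ i) refl)

⌊≟⌋-≢ : ∀ {n} {i j : Fin n} → i ≢ j → ⌊ i ≟ j ⌋ ≡ false
⌊≟⌋-≢ {i = i} {j} i≢j = trans (isYes≗does (i ≟ j)) (dec-false (i ≟ j) i≢j)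

module Reachability (G : WGraph) where
  open WGraph G

  infix 4 _⊆_
  infixl 6 _∖_
  infixr 5 _++_

  _⊆_ : EdgeSet G → EdgeSet G → Set
  S ⊆ S′ = ∀ e → S e ≡ true → S′ e ≡ true

  ⊆-trans : ∀ {S₁ S₂ S₃} → S₁ ⊆ S₂ → S₂ ⊆ S₃ → S₁ ⊆ S₃
  ⊆-trans 1⊆2 2⊆3 e = 2⊆3 e ∘ 1⊆2 e

  _∖_ : EdgeSet G → Fin m → EdgeSet G
  S ∖ e = removeEdge G S e

  ∖-intro : ∀ {S e h} → e ≢ h → S h ≡ true → (S ∖ e) h ≡ true
  ∖-intro {e = e} {h} e≢h Sh with e ≟ h
  ... | yes e≡h = contradiction e≡h e≢h
  ... | no  _   = Sh

  ∖-elim : ∀ {S e h} → (S ∖ e) h ≡ true → e ≢ h × S h ≡ true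
  ∖-elim {e = e} {h} Sh with e ≟ h
  ... | no e≢h = e≢h , Sh

  ∖-⊆ : ∀ {S e} → S ∖ e ⊆ S
  ∖-⊆ {S} {e} h = proj₂ ∘ ∖-elim {S} {e}

  ∖-mono : ∀ {S S′ e} → S ⊆ S′ → S ∖ e ⊆ S′ ∖ e
  ∖-mono {S} {S′} {e} S⊆S′ h Sh with ∖-elim {S} {e} Sh
  ... | e≢h , Sh′ = ∖-intro {S′} e≢h (S⊆S′ h Sh′)

  ∖-comm : ∀ {S e f} → S ∖ e ∖ f ⊆ S ∖ f ∖ e
  ∖-comm {S} {e} {f} h Sh with ∖-elim {S ∖ e} {f} Sh
  ... | f≢h , Sh′ with ∖-elim {S} {e} Sh′
  ...   | e≢h , Sh″ = ∖-intro {S ∖ f} e≢h (∖-intro {S} f≢h Sh″)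

  joins-sym : ∀ {e u v} → Joins G e u v → Joins G e v u
  joins-sym (inj₁ (s , d)) = inj₂ (s , d)
  joins-sym (inj₂ (s , d)) = inj₁ (s , d)

  joins-endpoint : ∀ {e u v x y} → Joins G e u v → Joins G e x y → u ≡ x ⊎ u ≡ y
  joins-endpoint (inj₁ (refl , _)) (inj₁ (refl , _)) = inj₁ refl
  joins-endpoint (inj₁ (refl , _)) (inj₂ (refl , _)) = inj₂ refl
  joins-endpoint (inj₂ (_ , refl)) (inj₁ (_ , refl)) = inj₂ refl
  joins-endpoint (inj₂ (_ , refl)) (inj₂ (_ , refl)) = inj₁ refl

  _++_ : ∀ {S u v w} → Reach G S u v → Reach G S v w → Reach G S u w
  here           ++ q = q
  step e Se j p  ++ q = step e Se j (p ++ q)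

  edge : ∀ {S e u v} → S e ≡ true → Joins G e u v → Reach G S u v
  edge Se j = step _ Se j here

  reach-sym : ∀ {S u v} → Reach G S u v → Reach G S v u
  reach-sym here            = here
  reach-sym (step e Se j p) = reach-sym p ++ edge Se (joins-sym j)

  reach-mono : ∀ {S S′ u v} → S ⊆ S′ → Reach G S u v → Reach G S′ u v
  reach-mono S⊆S′ here            = here
  reach-mono S⊆S′ (step e Se j p) = step e (S⊆S′ e Se) j (reach-mono S⊆S′ p)

  reach-ends : ∀ {S e u v} → Joins G e u v → Reach G S (src e) (dst e) → Reach G S u v
  reach-ends (inj₁ (refl , refl)) p = p
  reach-ends (inj₂ (refl , refl)) p = reach-sym p

  reach-ends⁻ : ∀ {S e u v} → Joins G e u v → Reach G S u v → Reach G S (src e) (dst e)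
  reach-ends⁻ (inj₁ (refl , refl)) p = p
  reach-ends⁻ (inj₂ (refl , refl)) p = reach-sym p

  reach-via : ∀ {S h x y} → S h ≡ true → Reach G S (src h) x → Reach G S y (dst h) → Reach G S x y
  reach-via Sh p q = reach-sym p ++ edge Sh (inj₁ (refl , refl)) ++ reach-sym q

  reach-split : ∀ {S u w} h → Reach G S u w →
    Reach G (S ∖ h) u w ⊎ ∃₂ λ x y → Joins G h x y × Reach G (S ∖ h) u x × Reach G (S ∖ h) y w
  reach-split h here = inj₁ here
  reach-split {S} h (step e Se j p) with h ≟ e | reach-split h p
  ... | no h≢e | inj₁ p′ = inj₁ (step e (∖-intro {S} h≢e Se) j p′)
  ... | no h≢e | inj₂ (x , y , j′ , p₁ , p₂) =
    inj₂ (x , y , j′ , step e (∖-intro {S} h≢e Se) j p₁ , p₂)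
  ... | yes refl | inj₁ p′ = inj₂ (_ , _ , j , here , p′)
  ... | yes refl | inj₂ (x , y , j′ , p₁ , p₂) with joins-endpoint j j′
  ...   | inj₁ refl = inj₂ (x , y , j′ , here , p₂)
  ...   | inj₂ refl = inj₁ p₂

  reach-reroute : ∀ {S S′ e u v} → S ∖ e ⊆ S′ → Reach G S′ (src e) (dst e) →
                  Reach G S u v → Reach G S′ u v
  reach-reroute           S∖e⊆S′ bypass here = here
  reach-reroute {S} {e = e} S∖e⊆S′ bypass (step h Sh j p) with e ≟ h
  ... | yes refl = reach-ends j bypass ++ reach-reroute S∖e⊆S′ bypass p
  ... | no  e≢h  = step h (S∖e⊆S′ h (∖-intro {S} e≢h Sh)) j (reach-reroute S∖e⊆S′ bypass p)

  reach-¬¬ : ∀ {L S u v} → (∀ f → L f ≡ true → ¬ ¬ Reach G S (src f) (dst f)) →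
             Reach G L u v → ¬ ¬ Reach G S u v
  reach-¬¬ lift here ¬p = ¬p here
  reach-¬¬ lift (step f Lf j p) ¬p =
    reach-¬¬ lift p λ q → lift f Lf λ r → ¬p (reach-ends j r ++ q)

module SpanningTrees (G : WGraph) where
  open WGraph G
  open Reachability G

  addEdge : EdgeSet G → Fin m → EdgeSet G
  addEdge S f h = if ⌊ f ≟ h ⌋ then true else S h

  addEdge-new : ∀ {S} f → addEdge S f f ≡ true
  addEdge-new f rewrite ⌊≟⌋-refl f = refl

  addEdge-elim : ∀ {S f h} → addEdge S f h ≡ true → f ≢ h → S h ≡ true
  addEdge-elim {f = f} {h} Sh f≢h rewrite ⌊≟⌋-≢ f≢h = Sh

  ⊆-addEdge : ∀ {S f} → S ⊆ addEdge S f
  ⊆-addEdge {f = f} h Sh with f ≟ h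
  ... | yes _ = refl
  ... | no  _ = Sh

  addEdge-∖ : ∀ {S f} → addEdge S f ∖ f ⊆ S
  addEdge-∖ {S} {f} h Sh with ∖-elim {addEdge S f} {f} Sh
  ... | f≢h , Sh′ = addEdge-elim {S} Sh′ f≢h

  edgeWeight : EdgeSet G → Fin m → ℕ
  edgeWeight S h = if S h then ew h else 0

  weight-∖ : ∀ {S e} → S e ≡ true → weight G (S ∖ e) + ew e ≡ weight G S
  weight-∖ {S} {e} Se = begin
    weight G (S ∖ e) + ew e            ≡⟨ cong (weight G (S ∖ e) +_) kept ⟨
    weight G (S ∖ e) + edgeWeight S e
      ≡⟨ sumFin-update (edgeWeight (S ∖ e)) (edgeWeight S) e agree ⟩
    weight G S + edgeWeight (S ∖ e) e  ≡⟨ cong (weight G S +_) removed ⟩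
    weight G S + 0                     ≡⟨ +-identityʳ _ ⟩
    weight G S                         ∎
    where
    open ≡-Reasoning
    kept : edgeWeight S e ≡ ew e
    kept rewrite Se = refl
    agree : ∀ h → h ≢ e → edgeWeight (S ∖ e) h ≡ edgeWeight S h
    agree h h≢e rewrite ⌊≟⌋-≢ (h≢e ∘ sym) = refl
    removed : edgeWeight (S ∖ e) e ≡ 0
    removed rewrite ⌊≟⌋-refl e = refl

  weight-addEdge : ∀ {S f} → S f ≡ false → weight G (addEdge S f) ≡ weight G S + ew f
  weight-addEdge {S} {f} Sf = begin
    weight G (addEdge S f)                  ≡⟨ +-identityʳ _ ⟨
    weight G (addEdge S f) + 0              ≡⟨ cong (weight G (addEdge S f) +_) absent ⟨
    weight G (addEdge S f) + edgeWeight S f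
      ≡⟨ sumFin-update (edgeWeight (addEdge S f)) (edgeWeight S) f agree ⟩
    weight G S + edgeWeight (addEdge S f) f ≡⟨ cong (weight G S +_) added ⟩
    weight G S + ew f                       ∎
    where
    open ≡-Reasoning
    agree : ∀ h → h ≢ f → edgeWeight (addEdge S f) h ≡ edgeWeight S h
    agree h h≢f rewrite ⌊≟⌋-≢ (h≢f ∘ sym) = refl
    absent : edgeWeight S f ≡ 0
    absent rewrite Sf = refl
    added : edgeWeight (addEdge S f) f ≡ ew f
    added rewrite addEdge-new {S} f = refl

  spanningTree-exchange : ∀ {T e f} → IsSpanningTree G T → T e ≡ true →
    ¬ Reach G (T ∖ e) (src f) (dst f) → IsSpanningTree G (addEdge (T ∖ e) f)
  spanningTree-exchange {T} {e} {f} (connected , bridges) Te cut = connected′ , bridges′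
    where
    T′ : EdgeSet G
    T′ = addEdge (T ∖ e) f

    T∖e⊆T′ : T ∖ e ⊆ T′
    T∖e⊆T′ = ⊆-addEdge {T ∖ e} {f}

    T′∖f⊆T∖e : T′ ∖ f ⊆ T ∖ e
    T′∖f⊆T∖e = addEdge-∖ {T ∖ e} {f}

    bypass : Reach G T′ (src e) (dst e)
    bypass with reach-split e (connected (src f) (dst f))
    ... | inj₁ avoiding = contradiction avoiding cut
    ... | inj₂ (x , y , j , p , q) =
      reach-ends⁻ j (reach-via (addEdge-new {T ∖ e} f) (reach-mono T∖e⊆T′ p) (reach-mono T∖e⊆T′ q))

    connected′ : Connected G T′
    connected′ u v = reach-reroute T∖e⊆T′ bypass (connected u v)

    T′∖g∖f⊆T∖e∖g : ∀ g → T′ ∖ g ∖ f ⊆ T ∖ e ∖ g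
    T′∖g∖f⊆T∖e∖g g = ⊆-trans (∖-comm {T′} {g} {f}) (∖-mono {T′ ∖ f} {T ∖ e} {g} T′∖f⊆T∖e)

    T′∖g∖f⊆T∖e : ∀ g → T′ ∖ g ∖ f ⊆ T ∖ e
    T′∖g∖f⊆T∖e g = ⊆-trans (T′∖g∖f⊆T∖e∖g g) (∖-⊆ {T ∖ e} {g})

    T′∖g∖f⊆T∖g : ∀ g → T′ ∖ g ∖ f ⊆ T ∖ g
    T′∖g∖f⊆T∖g g = ⊆-trans (T′∖g∖f⊆T∖e∖g g) (∖-mono {T ∖ e} {T} {g} (∖-⊆ {T} {e}))

    -- In the second clause matching on f ≟ g has turned T′g into a proof of (T ∖ e) g ≡ true.
    bridges′ : ∀ g → T′ g ≡ true → ¬ Reach G (T′ ∖ g) (src g) (dst g)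
    bridges′ g T′g P with f ≟ g
    ... | yes refl = cut (reach-mono T′∖f⊆T∖e P)
    ... | no  f≢g with reach-split f P
    ...   | inj₁ avoiding = bridges g (∖-⊆ {T} g T′g) (reach-mono (T′∖g∖f⊆T∖g g) avoiding)
    ...   | inj₂ (x , y , j , p , q) =
      cut (reach-ends⁻ j (reach-via T′g (reach-mono (T′∖g∖f⊆T∖e g) p)
                                        (reach-mono (T′∖g∖f⊆T∖e g) q)))

  mst-cut : ∀ {T e f} → IsMST G T → T e ≡ true →
            ¬ Reach G (T ∖ e) (src f) (dst f) → ew e ≤ ew f
  mst-cut {T} {e} {f} (tree , minimal) Te cut with f ≟ e
  ... | yes refl = ≤-refl
  ... | no  f≢e  = +-cancelˡ-≤ (weight G T) (ew e) (ew f) (begin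
    weight G T + ew e
      ≤⟨ +-monoˡ-≤ (ew e) (minimal T′ (spanningTree-exchange tree Te cut)) ⟩
    weight G T′ + ew e                    ≡⟨ cong (_+ ew e) (weight-addEdge f∉T∖e) ⟩
    weight G (T ∖ e) + ew f + ew e        ≡⟨ +-assoc (weight G (T ∖ e)) _ _ ⟩
    weight G (T ∖ e) + (ew f + ew e)      ≡⟨ cong (weight G (T ∖ e) +_) (+-comm (ew f) (ew e)) ⟩
    weight G (T ∖ e) + (ew e + ew f)      ≡⟨ +-assoc (weight G (T ∖ e)) _ _ ⟨
    weight G (T ∖ e) + ew e + ew f        ≡⟨ cong (_+ ew f) (weight-∖ Te) ⟩
    weight G T + ew f                     ∎)
    where
    open ≤-Reasoning
    T′ : EdgeSet G
    T′ = addEdge (T ∖ e) f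
    f∉T∖e : (T ∖ e) f ≡ false
    f∉T∖e = ¬-not λ T∖e∋f → cut (edge T∖e∋f (inj₁ (refl , refl)))

  -- Some edge of an L-path between the ends of e reconnects T ∖ e; constructively we cannot
  -- say which, hence the double negation.
  mst-bottleneck : ∀ {T L k} → IsMST G T → Connected G L → (∀ f → L f ≡ true → ew f ≤ k) →
                   ∀ e → T e ≡ true → ew e ≤ k
  mst-bottleneck {T} {L} {k} mst L-connected L-light e Te with ew e ≤? k
  ... | yes e≤k = e≤k
  ... | no  e≰k = contradiction (proj₂ (proj₁ mst) e Te) (reach-¬¬ crossing (L-connected (src e) (dst e)))
    where
    crossing : ∀ f → L f ≡ true → ¬ ¬ Reach G (T ∖ e) (src f) (dst f)
    crossing f Lf cut = e≰k (≤-trans (mst-cut mst Te cut) (L-light f Lf))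

module Walks (G : WGraph) {S : EdgeSet G} where
  open WGraph G
  open Reachability G

  length : ∀ {u w} → Reach G S u w → ℕ
  length here           = 0
  length (step _ _ _ p) = suc (length p)

  vertexAt : ∀ {u w} → Reach G S u w → ℕ → Fin n
  vertexAt {u} here           t       = u
  vertexAt {u} (step _ _ _ p) zero    = u
  vertexAt     (step _ _ _ p) (suc t) = vertexAt p t

  edgeAt : ∀ {u w} → Reach G S u w → ℕ → Maybe (Fin m)
  edgeAt here           t       = nothing
  edgeAt (step e _ _ p) zero    = just e
  edgeAt (step _ _ _ p) (suc t) = edgeAt p t

  vertexAt-zero : ∀ {u w} (p : Reach G S u w) → vertexAt p 0 ≡ u
  vertexAt-zero here           = refl
  vertexAt-zero (step _ _ _ p) = refl

  vertexAt-length : ∀ {u w} (p : Reach G S u w) → vertexAt p (length p) ≡ w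
  vertexAt-length here           = refl
  vertexAt-length (step _ _ _ p) = vertexAt-length p

  edgeAt-nothing : ∀ {u w} (p : Reach G S u w) t → edgeAt p t ≡ nothing →
                   vertexAt p (suc t) ≡ vertexAt p t
  edgeAt-nothing here           t       _  = refl
  edgeAt-nothing (step _ _ _ p) (suc t) eq = edgeAt-nothing p t eq

  edgeAt-just : ∀ {u w} (p : Reach G S u w) t {e} → edgeAt p t ≡ just e →
                S e ≡ true × Joins G e (vertexAt p t) (vertexAt p (suc t))
  edgeAt-just (step e Se j p) zero    refl = Se , subst (Joins G e _) (sym (vertexAt-zero p)) j
  edgeAt-just (step _ _  _ p) (suc t) eq   = edgeAt-just p t eq

  infix 4 _∈ʷ_

  data _∈ʷ_ (v : Fin n) : ∀ {u w} → Reach G S u w → Set where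
    start : ∀ {w} {p : Reach G S v w} → v ∈ʷ p
    later : ∀ {u x w e Se j} {p : Reach G S x w} → v ∈ʷ p → v ∈ʷ step {u = u} e Se j p

  ∈ʷ-end : ∀ {u w} (p : Reach G S u w) → w ∈ʷ p
  ∈ʷ-end here           = start
  ∈ʷ-end (step _ _ _ p) = later (∈ʷ-end p)

  ∈ʷ-++ˡ : ∀ {v u x w} {p : Reach G S u x} (q : Reach G S x w) → v ∈ʷ p → v ∈ʷ p ++ q
  ∈ʷ-++ˡ q start     = start
  ∈ʷ-++ˡ q (later i) = later (∈ʷ-++ˡ q i)

  ∈ʷ-++ʳ : ∀ {v u x w} (p : Reach G S u x) {q : Reach G S x w} → v ∈ʷ q → v ∈ʷ p ++ q
  ∈ʷ-++ʳ here           i = i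
  ∈ʷ-++ʳ (step _ _ _ p) i = later (∈ʷ-++ʳ p i)

  ∈ʷ-vertexAt : ∀ {v u w} {p : Reach G S u w} → v ∈ʷ p →
                ∃[ t ] (t ≤ length p × vertexAt p t ≡ v)
  ∈ʷ-vertexAt {p = p} start = 0 , z≤n , vertexAt-zero p
  ∈ʷ-vertexAt (later i) with ∈ʷ-vertexAt i
  ... | t , t≤ , at = suc t , s≤s t≤ , at

  concatLoops : ∀ {x k} → (Fin k → Reach G S x x) → Reach G S x x
  concatLoops {k = zero}  loops = here
  concatLoops {k = suc k} loops = loops zero ++ concatLoops (loops ∘ suc)

  ∈ʷ-concatLoops : ∀ {v x k} (loops : Fin k → Reach G S x x) i →
                   v ∈ʷ loops i → v ∈ʷ concatLoops loops
  ∈ʷ-concatLoops loops zero    i = ∈ʷ-++ˡ _ i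
  ∈ʷ-concatLoops loops (suc j) i = ∈ʷ-++ʳ (loops zero) (∈ʷ-concatLoops (loops ∘ suc) j i)

  covering-closedWalk : Connected G S → ∀ x → Σ (Reach G S x x) λ W → ∀ v → v ∈ʷ W
  covering-closedWalk connected x =
    concatLoops loop , λ v → ∈ʷ-concatLoops loop v (∈ʷ-++ˡ (connected v x) (∈ʷ-end (connected x v)))
    where
    loop : Fin n → Reach G S x x
    loop v = connected x v ++ connected v x

module Strategies (G : WGraph) where
  open WGraph G
  open Reachability G

  lightEdges : ℕ → EdgeSet G
  lightEdges k e = ⌊ ew e ≤? k ⌋

  lightEdges-≤ : ∀ {k} e → lightEdges k e ≡ true → ew e ≤ k
  lightEdges-≤ {k} e light with ew e ≤? k
  ... | yes e≤k = e≤k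

  ≤-lightEdges : ∀ {k e} → ew e ≤ k → lightEdges k e ≡ true
  ≤-lightEdges {k} {e} e≤k = trans (isYes≗does (ew e ≤? k)) (dec-true (ew e ≤? k) e≤k)

  module _ {S var vs k} {σ : Schedule G k} (valid : ValidStrategy G S var vs k σ) where
    open Schedule σ
    open ValidStrategy valid

    -- A moving group has at most k agents, so it only crosses edges of weight at most k.
    position-reaches-start : ∀ t a → Reach G (lightEdges k) (pos t a) vs
    position-reaches-start zero    a = subst (λ x → Reach G (lightEdges k) x vs) (sym (start a)) here
    position-reaches-start (suc t) a with mv t a in moved
    ... | nothing = subst (λ x → Reach G (lightEdges k) x vs) (sym (stay t a moved))
                          (position-reaches-start t a)
    ... | just e  = step e (≤-lightEdges (≤-trans (capacity t a e moved) (count-≤ _)))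
                          (joins-sym (proj₂ (move t a e moved))) (position-reaches-start t a)

    lightEdges-connected : Connected G (lightEdges k)
    lightEdges-connected u v = toStart u ++ reach-sym (toStart v)
      where
      toStart : ∀ v → Reach G (lightEdges k) v vs
      toStart v with filled v
      ... | t , ((a , at) , _) , _ = subst (λ x → Reach G (lightEdges k) x vs) at (position-reaches-start t a)

  firstVisit-unique : ∀ {k} {σ : Schedule G k} {v s t} → FirstVisit σ v s → FirstVisit σ v t → s ≡ t
  firstVisit-unique {s = s} {t} ((a , a-at) , a-first) ((b , b-at) , b-first) with <-cmp s t
  ... | tri< s<t _ _ = contradiction a-at (b-first s s<t a)
  ... | tri≈ _ s≡t _ = s≡t
  ... | tri> _ _ t<s = contradiction b-at (a-first t t<s b)

  settleVertex : ∀ {k} → Schedule G k → Fin k → Maybe (Fin n)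
  settleVertex σ a = Maybe.map (λ s → Schedule.pos σ s a) (Schedule.settle σ a)

  SettlesFirst : ∀ {k} → Schedule G k → Set
  SettlesFirst σ = ∀ a s → Schedule.settle σ a ≡ just s → FirstVisit σ (Schedule.pos σ s a) s

  -- An agent settling at v does so at the first visit of v, which is unique.
  settledCount-firstVisit : ∀ {k} {σ : Schedule G k} {v t} → SettlesFirst σ → FirstVisit σ v t →
    settledCount σ v t ≡ count (λ a → eqMaybeFin (settleVertex σ a) (just v))
  settledCount-firstVisit {σ = σ} {v} {t} settlesFirst first = count-ext pointwise
    where
    open Schedule σ
    pointwise : ∀ a → (eqMaybeℕ (settle a) (just t) ∧ ⌊ pos t a ≟ v ⌋)
                      ≡ eqMaybeFin (settleVertex σ a) (just v)
    pointwise a with settle a in settled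
    ... | nothing = refl
    ... | just s with s ℕ.≟ t
    ...   | yes refl = refl
    ...   | no  s≢t with pos s a ≟ v
    ...     | yes refl = contradiction (firstVisit-unique {σ = σ} (settlesFirst a s settled) first) s≢t
    ...     | no  _    = refl

module FollowWalk (G : WGraph) {S : EdgeSet G} {vs : Fin (WGraph.n G)} (W : Reach G S vs vs)
                  (covers : ∀ v → Walks._∈ʷ_ G v W)
                  {K : ℕ} (target : Fin K → Maybe (Fin (WGraph.n G))) where
  open WGraph G
  open Walks G
  open Strategies G

  firstTime-spec : ∀ v →
    ∃[ t ] (t ≤ length W × vertexAt W t ≡ v × (∀ i → i < t → vertexAt W i ≢ v))
  firstTime-spec v with ∈ʷ-vertexAt (covers v)
  ... | t , t≤ , at with least (λ i → vertexAt W i ≟ v) at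
  ...   | s , s≤t , hit , before = s , ≤-trans s≤t t≤ , hit , before

  firstTime : Fin n → ℕ
  firstTime v = proj₁ (firstTime-spec v)

  firstTime-≤ : ∀ v → firstTime v ≤ length W
  firstTime-≤ v = proj₁ (proj₂ (firstTime-spec v))

  vertexAt-firstTime : ∀ v → vertexAt W (firstTime v) ≡ v
  vertexAt-firstTime v = proj₁ (proj₂ (proj₂ (firstTime-spec v)))

  before-firstTime : ∀ v i → i < firstTime v → vertexAt W i ≢ v
  before-firstTime v = proj₂ (proj₂ (proj₂ (firstTime-spec v)))

  clock : Maybe ℕ → ℕ → ℕ
  clock nothing  t = t
  clock (just s) t = t ⊓ s

  advance : Maybe ℕ → ℕ → Maybe (Fin m)
  advance nothing  t = edgeAt W t
  advance (just s) t = if ⌊ t <? s ⌋ then edgeAt W t else nothing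

  haltTime : Maybe (Fin n) → Maybe ℕ
  haltTime = Maybe.map firstTime

  -- Agents without a target walk W for ever; an agent with target d walks W until W first reaches d.
  schedule : Schedule G K
  schedule = record
    { pos    = λ t b → vertexAt W (clock (haltTime (target b)) t)
    ; mv     = λ t b → advance (haltTime (target b)) t
    ; settle = λ b → haltTime (target b)
    }

  open Schedule schedule

  clock-≤ : ∀ h t → clock h t ≤ t
  clock-≤ nothing  t = ≤-refl
  clock-≤ (just s) t = m⊓n≤m t s

  advance-nothing : ∀ h t → advance h t ≡ nothing → vertexAt W (clock h (suc t)) ≡ vertexAt W (clock h t)
  advance-nothing nothing  t stays = edgeAt-nothing W t stays
  advance-nothing (just s) t stays with t <? s
  ... | yes t<s = begin
    vertexAt W (suc t ⊓ s) ≡⟨ cong (vertexAt W) (m≤n⇒m⊓n≡m t<s) ⟩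
    vertexAt W (suc t)     ≡⟨ edgeAt-nothing W t stays ⟩
    vertexAt W t           ≡⟨ cong (vertexAt W) (m≤n⇒m⊓n≡m (<⇒≤ t<s)) ⟨
    vertexAt W (t ⊓ s)     ∎
    where open ≡-Reasoning
  ... | no  t≮s =
    cong (vertexAt W) (trans (m≥n⇒m⊓n≡n (m≤n⇒m≤1+n (≮⇒≥ t≮s))) (sym (m≥n⇒m⊓n≡n (≮⇒≥ t≮s))))

  advance-just : ∀ h t {e} → advance h t ≡ just e →
                 edgeAt W t ≡ just e × clock h t ≡ t × clock h (suc t) ≡ suc t
  advance-just nothing  t moves = moves , refl , refl
  advance-just (just s) t moves with t <? s
  ... | yes t<s = moves , m≤n⇒m⊓n≡m (<⇒≤ t<s) , m≤n⇒m⊓n≡m t<s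

  advance-halted : ∀ s t → s ≤ t → advance (just s) t ≡ nothing
  advance-halted s t s≤t with t <? s
  ... | yes t<s = contradiction s≤t (<⇒≱ t<s)
  ... | no  _   = refl

  haltTime-just : ∀ {d s} → haltTime d ≡ just s → ∃[ v ] (d ≡ just v × firstTime v ≡ s)
  haltTime-just {just v} refl = v , refl , refl

  settleVertex-schedule : ∀ b → settleVertex schedule b ≡ target b
  settleVertex-schedule b with target b
  ... | nothing = refl
  ... | just v  = cong just (trans (cong (vertexAt W) (⊓-idem (firstTime v))) (vertexAt-firstTime v))

  firstVisit-schedule : ∀ {v s} b → pos s b ≡ v → (∀ i → i < s → vertexAt W i ≢ v) →
                        FirstVisit schedule v s
  firstVisit-schedule b at unvisited =
    (b , at) , λ t t<s c → unvisited _ (≤-<-trans (clock-≤ (haltTime (target c)) t) t<s)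

  settlesFirst : SettlesFirst schedule
  settlesFirst b s halts with haltTime-just {target b} halts
  ... | v , targets-v , refl = subst (λ x → FirstVisit schedule x (firstTime v)) (sym at-v)
                                     (firstVisit-schedule b at-v (before-firstTime v))
    where
    at-v : pos (firstTime v) b ≡ v
    at-v = trans (cong (λ d → vertexAt W (clock (haltTime d) (firstTime v))) targets-v)
                 (trans (cong (vertexAt W) (⊓-idem (firstTime v))) (vertexAt-firstTime v))

  module _ {c} (c-untargeted : target c ≡ nothing) where
    carrier-pos : ∀ t → pos t c ≡ vertexAt W t
    carrier-pos t = cong (λ d → vertexAt W (clock (haltTime d) t)) c-untargeted

    carrier-mv : ∀ t → mv t c ≡ edgeAt W t
    carrier-mv t = cong (λ d → advance (haltTime d) t) c-untargeted

  Carrier : Fin K → Bool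
  Carrier = is-nothing ∘ target

  carrier-untargeted : ∀ {c} → Carrier c ≡ true → target c ≡ nothing
  carrier-untargeted {c} carrier with target c
  ... | nothing = refl

  capacity : (∀ e → S e ≡ true → ew e ≤ count Carrier) →
             ∀ t a e → mv t a ≡ just e → ew e ≤ groupSize schedule t e (pos t a)
  capacity light t a e moves with advance-just (haltTime (target a)) t moves
  ... | edge-e , on-walk , _ = ≤-trans (light e (proj₁ (edgeAt-just W t edge-e))) (count-mono carrier-joins)
    where
    carrier-joins : ∀ c → Carrier c ≡ true →
                    (eqMaybeFin (mv t c) (just e) ∧ ⌊ pos t c ≟ pos t a ⌋) ≡ true
    carrier-joins c carrier
      rewrite carrier-mv (carrier-untargeted carrier) t | edge-e | ⌊≟⌋-refl e
            | carrier-pos (carrier-untargeted carrier) t | on-walk = ⌊≟⌋-refl (vertexAt W t)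

  valid : ∀ var → ∃[ c ] target c ≡ nothing → (∀ e → S e ≡ true → ew e ≤ count Carrier) →
          (∀ v → count (λ b → eqMaybeFin (target b) (just v)) ≡ vw v) →
          ValidStrategy G S var vs K schedule
  valid var (c , c-untargeted) light settling = record
    { start       = λ b → trans (cong (vertexAt W) (clock-zero (haltTime (target b)))) (vertexAt-zero W)
    ; stay        = λ t b → advance-nothing (haltTime (target b)) t
    ; move        = λ t b e moves → moved t b e moves
    ; capacity    = capacity light
    ; settled     = λ b s halts t s≤t → trans (cong (λ h → advance h t) halts) (advance-halted s t s≤t)
    ; settleFirst = settlesFirst
    ; filled      = λ v → firstTime v , first v , filled v
    ; returns     = λ _ → length W , λ v →
                      c , trans (carrier-pos c-untargeted (length W)) (vertexAt-length W)
                        , firstTime v , firstTime-≤ v , carrier-at v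
    }
    where
    clock-zero : ∀ h → clock h 0 ≡ 0
    clock-zero nothing  = refl
    clock-zero (just s) = refl

    carrier-at : ∀ v → pos (firstTime v) c ≡ v
    carrier-at v = trans (carrier-pos c-untargeted (firstTime v)) (vertexAt-firstTime v)

    moved : ∀ t b e → mv t b ≡ just e → S e ≡ true × Joins G e (pos t b) (pos (suc t) b)
    moved t b e moves with advance-just (haltTime (target b)) t moves
    ... | edge-e , now , next rewrite now | next = edgeAt-just W t edge-e

    first : ∀ v → FirstVisit schedule v (firstTime v)
    first v = firstVisit-schedule c (carrier-at v) (before-firstTime v)

    filled : ∀ v → settledCount schedule v (firstTime v) ≡ vw v
    filled v = begin
      settledCount schedule v (firstTime v)
        ≡⟨ settledCount-firstVisit {σ = schedule} settlesFirst (first v) ⟩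
      count (λ b → eqMaybeFin (settleVertex schedule b) (just v))
        ≡⟨ count-ext (λ b → cong (λ d → eqMaybeFin d (just v)) (settleVertex-schedule b)) ⟩
      count (λ b → eqMaybeFin (target b) (just v))        ≡⟨ settling v ⟩
      vw v                                                ∎
      where open ≡-Reasoning

mst-deployable-twice : ∀ {G S var vs k T} → Deployable G S var vs k → IsMST G T →
                       Deployable G T var vs (k + k)
mst-deployable-twice {G} {S} {var} {vs} {k} {T} (σ , σ-valid) mst =
  schedule , valid var carrier light settling
  where
  open WGraph G
  open SpanningTrees G
  open Walks G
  open Strategies G

  tree-light : ∀ e → T e ≡ true → ew e ≤ k
  tree-light = mst-bottleneck mst (lightEdges-connected σ-valid) lightEdges-≤

  tour : Σ (Reach G T vs vs) λ W → ∀ v → v ∈ʷ W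
  tour = covering-closedWalk (proj₁ (proj₁ mst)) vs

  target : Fin (k + k) → Maybe (Fin n)
  target b = [ const nothing , settleVertex σ ]′ (splitAt k b)

  open FollowWalk G (proj₁ tour) (proj₂ tour) target

  target-carrier : ∀ i → target (i ↑ˡ k) ≡ nothing
  target-carrier i = cong [ const nothing , settleVertex σ ]′ (splitAt-↑ˡ k i k)

  target-copy : ∀ i → target (k ↑ʳ i) ≡ settleVertex σ i
  target-copy i = cong [ const nothing , settleVertex σ ]′ (splitAt-↑ʳ k k i)

  carrier : ∃[ c ] target c ≡ nothing
  carrier with ValidStrategy.filled σ-valid vs
  ... | _ , ((a , _) , _) , _ = a ↑ˡ k , target-carrier a

  light : ∀ e → T e ≡ true → ew e ≤ count Carrier
  light e Te = begin
    ew e                                                  ≤⟨ tree-light e Te ⟩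
    k                                                     ≡⟨ count-true (cong is-nothing ∘ target-carrier) ⟨
    count (Carrier ∘ (_↑ˡ k))                             ≤⟨ m≤m+n _ _ ⟩
    count (Carrier ∘ (_↑ˡ k)) + count (Carrier ∘ (k ↑ʳ_)) ≡⟨ count-++ k Carrier ⟨
    count Carrier                                         ∎
    where open ≤-Reasoning

  settling : ∀ v → count (λ b → eqMaybeFin (target b) (just v)) ≡ vw v
  settling v with ValidStrategy.filled σ-valid v
  ... | t , first , settled = begin
    count targets-v                                            ≡⟨ count-++ k targets-v ⟩
    count (targets-v ∘ (_↑ˡ k)) + count (targets-v ∘ (k ↑ʳ_))  ≡⟨ cong₂ _+_ carriers copies ⟩
    0 + count (λ a → eqMaybeFin (settleVertex σ a) (just v))
      ≡⟨ settledCount-firstVisit {σ = σ} (ValidStrategy.settleFirst σ-valid) first ⟨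
    settledCount σ v t                                         ≡⟨ settled ⟩
    vw v                                                       ∎
    where
    open ≡-Reasoning
    targets-v : Fin (k + k) → Bool
    targets-v b = eqMaybeFin (target b) (just v)
    carriers : count (targets-v ∘ (_↑ˡ k)) ≡ 0
    carriers = count-false (cong (λ d → eqMaybeFin d (just v)) ∘ target-carrier)
    copies : count (targets-v ∘ (k ↑ʳ_)) ≡ count (λ a → eqMaybeFin (settleVertex σ a) (just v))
    copies = count-ext (cong (λ d → eqMaybeFin d (just v)) ∘ target-copy)

lemma2 : (G : WGraph) (vs : Fin (WGraph.n G)) (var : Variant) →
         Connected G (allEdges G) →
         (T : EdgeSet G) → IsMST G T →
         (kopt kMST : ℕ) →
         OptimalAgents G (allEdges G) var vs kopt →
         OptimalAgents G T var vs kMST →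
         kMST ≤ 2 * kopt
lemma2 G vs var _ T mst kopt kMST (optimal , _) (_ , minimal) =
  minimal (2 * kopt) (subst (Deployable G T var vs) (cong (kopt +_) (sym (+-identityʳ kopt)))
                            (mst-deployable-twice optimal mst))
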